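{- Let $G$ be a nice graph with $V_4$ the set of its vertices of degree at least $4$, let $\mathcal{P}$ be a path partition of $G$, let $\mathcal{P}_4\subseteq\mathcal{P}$ be the subfamily of paths visiting at least one vertex of $V_4$, let $\ell\in\mathbb{N}$, and let $(\mathcal{T},d)$ be a $(G,V_4,\ell)$-pattern encoding $\mathcal{P}_4$. Then $$|\mathcal{P}|\ge\frac{\mathrm{odd}(G)+\mathrm{odd}(\mathcal{T},d)}{2}+|\mathcal{T}|.$$
   Context: All graphs are finite, simple and undirected; subcubic means maximum degree at most $3$. A path partition of $G$ is a collection of pairwise edge-disjoint paths whose edge sets together cover $E(G)$. $\mathrm{odd}(H)$ is the number of odd-degree vertices of $H$. A cycle $C$ in $G$ is a pan cycle if exactly one vertex of $C$ has degree $3$ in $G$ and all others degree $2$; a bull cycle if exactly two have degree $3$ and all others degree $2$. $G$ is nice if it is connected, not subcubic, has no pan cycles, and every bull cycle has length $3$. $N_G(S)$, $N_G[S]$ are open/closed neighborhoods. Terminal collection for a family $\mathcal{Q}$ of edge-disjoint paths: $U\subseteq V(G)$ with $N_G[V_4]\subseteq U$, containing both endpoints of every path of $\mathcal{Q}$, and such that for all $u,v\in U$, if two distinct paths of $\mathcal{Q}$ both visit $u$ and $v$, then at least one visits another vertex of $U$ between $u$ and $v$. $X_\ell=\{x_1,\dots,x_\ell\}$ are formal variables disjoint from $V(G)$. A $(G,V_4,\ell)$-trace is a finite sequence over $N_G[V_4]\cup X_\ell$ with no repeated symbol and no variable consecutive to a vertex of $V_4$. For a trace $T=(t_1,\dots,t_r)$: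 $\mathsf{edges}(T)$ = unordered consecutive pairs $t_it_{i+1}$ containing a symbol of $V_4$; $\mathsf{ends}(T)$ = the other consecutive pairs; $\deg_T(y)$ is $0$ if $y$ is not on $T$, $1$ if $y\in\{t_1,t_r\}$, $2$ otherwise. A $(G,V_4,\ell)$-pattern is $(\mathcal{T},d)$, $\mathcal{T}$ a collection of traces, $d:X_\ell\to\{1,2,3\}$, with: distinct traces have disjoint $\mathsf{ends}$ and disjoint $\mathsf{edges}$ sets; $\bigcup_T\mathsf{edges}(T)$ equals the set of edges incident to $V_4$; $\sum_T\deg_T(x_i)\le d(x_i)$ for all $x_i$; $\sum_T\deg_T(v)\le\deg_G(v)$ for all $v\in N_G(V_4)$. $|\mathcal{T}|$ is the number of traces. Encoding: $(\mathcal{T},d)$ encodes $\mathcal{Q}$ if for some terminal collection $U$ of $\mathcal{Q}$, $V_X=U\setminus N_G[V_4]$, $\ell=|V_X|$, and a bijection $f:X_\ell\to V_X$, $\mathcal{T}$ consists of, for each $P\in\mathcal{Q}$ (arbitrarily oriented), the sequence of vertices of $P$ in $N_G[V_4]\cup V_X$ in order with each $v\in V_X$ replaced by $f^{ -1}(v)$, and $d(x_i)=\deg_G(f(x_i))$. Odd number of a pattern: $v\in N_G[V_4]$ (resp. $v\in X_\ell$) loses oddity if $\deg_G(v)$ (resp. $d(v)$) is odd and $\sum_T\deg_T(v)$ is odd; gains oddity if $\deg_G(v)$ (resp. $d(v)$) is even and $\sum_T\deg_T(v)$ is odd. $\mathrm{odd}(\mathcal{T},d)$ = number gaining oddity minus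 number losing oddity. -}

module Defs where

open import Data.Nat using (ℕ; zero; suc; _+_; _*_; _≤_; _≤ᵇ_)
open import Data.Integer as ℤ using (ℤ; +_; _-_)
open import Data.Fin as Fin using (Fin)
open import Data.Bool using (Bool; true; false; T; _∧_; _∨_; not; if_then_else_)
open import Data.List using (List; []; _∷_; _++_; _∷ʳ_; length; filterᵇ; allFin; map; lookup; reverse)
open import Data.Bool.ListAction using (any)
open import Data.Nat.ListAction using (sum)
open import Data.List.Membership.Propositional using (_∈_)
open import Data.List.Relation.Unary.All using (All)
open import Data.List.Relation.Unary.Any using (Any)
open import Data.List.Relation.Unary.Unique.Propositional using (Unique)
open import Data.List.Relation.Unary.Linked using (Linked)
open import Data.List.Relation.Binary.Pointwise using (Pointwise)
open import Data.Sum using (_⊎_; inj₁; inj₂; [_,_])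
open import Data.Sum.Properties using (≡-dec)
open import Data.Product using (Σ; ∃; ∃-syntax; _×_; _,_)
open import Data.Unit using (⊤)
open import Data.Empty using (⊥)
open import Relation.Nullary using (¬_; does)
open import Relation.Binary.PropositionalEquality using (_≡_; _≢_)
open import Function.Definitions using (Injective)
open import Function.Bundles using (_⤖_; Bijection)

record Graph : Set where
  field
    n     : ℕ
    adj   : Fin n → Fin n → Bool
    sym   : ∀ u v → adj u v ≡ adj v u
    irrefl : ∀ v → adj v v ≡ false

module _ (G : Graph) where
  open Graph G

  V : Set
  V = Fin n

  Adj : V → V → Set
  Adj u v = T (adj u v)

  deg : V → ℕ
  deg v = length (filterᵇ (adj v) (allFin n))

  isV4 : V → Bool
  isV4 v = 4 ≤ᵇ deg v

  inOpenN : V → Bool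
  inOpenN v = any (λ u → adj v u ∧ isV4 u) (allFin n)

  inClosedN : V → Bool
  inClosedN v = isV4 v ∨ inOpenN v

Consec : {A : Set} → List A → A → A → Set
Consec {A} xs u v = Σ (List A) λ as → Σ (List A) λ bs → xs ≡ as ++ u ∷ v ∷ bs

ConsecPair : {A : Set} → List A → A → A → Set
ConsecPair xs u v = Consec xs u v ⊎ Consec xs v u

IsEndpoint : {A : Set} → List A → A → Set
IsEndpoint {A} xs v = (Σ (List A) λ ys → xs ≡ v ∷ ys) ⊎ (Σ (List A) λ ys → xs ≡ ys ∷ʳ v)

Between : {A : Set} → List A → A → A → A → Set
Between {A} xs u v w = Σ (List A) λ as → Σ (List A) λ bs → Σ (List A) λ cs →
  (xs ≡ as ++ u ∷ bs ++ v ∷ cs ⊎ xs ≡ as ++ v ∷ bs ++ u ∷ cs) × w ∈ bs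

isOdd : ℕ → Bool
isOdd zero    = false
isOdd (suc k) = not (isOdd k)

count : {A : Set} → (A → Bool) → List A → ℕ
count p xs = length (filterᵇ p xs)

module _ (G : Graph) where
  open Graph G

  data Reach : V G → V G → Set where
    here : ∀ {v} → Reach v v
    step : ∀ {u w v} → Adj G u w → Reach w v → Reach u v

  Connected : Set
  Connected = ∀ u v → Reach u v

  Subcubic : Set
  Subcubic = ∀ v → deg G v ≤ 3

  IsCycle : List (V G) → Set
  IsCycle []       = ⊥
  IsCycle (a ∷ cs) = Unique (a ∷ cs) × 3 ≤ length (a ∷ cs) × Linked (Adj G) ((a ∷ cs) ∷ʳ a)

  deg3 : V G → Bool
  deg3 v = does (Data.Nat._≟_ (deg G v) 3)

  Deg2or3 : V G → Set
  Deg2or3 v = deg G v ≡ 2 ⊎ deg G v ≡ 3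

  PanCycle : List (V G) → Set
  PanCycle c = IsCycle c × All Deg2or3 c × count deg3 c ≡ 1

  BullCycle : List (V G) → Set
  BullCycle c = IsCycle c × All Deg2or3 c × count deg3 c ≡ 2

  Nice : Set
  Nice = Connected × ¬ Subcubic × (∀ c → ¬ PanCycle c) × (∀ c → BullCycle c → length c ≡ 3)

  record Path : Set where
    field
      verts  : List (V G)
      unique : Unique verts
      linked : Linked (Adj G) verts
      nontriv : 2 ≤ length verts

  open Path public

  EdgeIn : Path → V G → V G → Set
  EdgeIn p u v = ConsecPair (verts p) u v

  IsPathPartition : List Path → Set
  IsPathPartition P =
    (∀ (i j : Fin (length P)) → i ≢ j → ∀ u v → EdgeIn (lookup P i) u v → ¬ EdgeIn (lookup P j) u v)
    × (∀ u v → Adj G u v → Any (λ p → EdgeIn p u v) P)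

  visitsV4 : Path → Bool
  visitsV4 p = any (isV4 G) (verts p)

  P4 : List Path → List Path
  P4 P = filterᵇ visitsV4 P

  IsTerminalCollection : List Path → (V G → Bool) → Set
  IsTerminalCollection Q U =
    (∀ v → T (inClosedN G v) → T (U v))
    × All (λ p → ∀ v → IsEndpoint (verts p) v → T (U v)) Q
    × (∀ (i j : Fin (length Q)) → i ≢ j → ∀ u v → u ≢ v → T (U u) → T (U v)
         → u ∈ verts (lookup Q i) → v ∈ verts (lookup Q i)
         → u ∈ verts (lookup Q j) → v ∈ verts (lookup Q j)
         → (∃[ w ] T (U w) × Between (verts (lookup Q i)) u v w)
           ⊎ (∃[ w ] T (U w) × Between (verts (lookup Q j)) u v w))

  -- symbols: vertices (inj₁) or formal variables x₁..x_ℓ (inj₂)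
  Sym : ℕ → Set
  Sym ℓ = V G ⊎ Fin ℓ

  Trace : ℕ → Set
  Trace ℓ = List (Sym ℓ)

module _ (G : Graph) (ℓ : ℕ) where
  open Graph G

  symEq : Sym G ℓ → Sym G ℓ → Bool
  symEq a b = does (≡-dec Fin._≟_ Fin._≟_ a b)

  isV4Sym : Sym G ℓ → Bool
  isV4Sym (inj₁ v) = isV4 G v
  isV4Sym (inj₂ _) = false

  OkSym : Sym G ℓ → Set
  OkSym (inj₁ v) = T (inClosedN G v)
  OkSym (inj₂ _) = ⊤

  IsTrace : Trace G ℓ → Set
  IsTrace t = Unique t × All OkSym t
    × (∀ (x : Fin ℓ) (v : V G) → T (isV4 G v) → ¬ ConsecPair t (inj₂ x) (inj₁ v))

  InEdges : Trace G ℓ → Sym G ℓ → Sym G ℓ → Set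
  InEdges t a b = ConsecPair t a b × T (isV4Sym a ∨ isV4Sym b)

  InEnds : Trace G ℓ → Sym G ℓ → Sym G ℓ → Set
  InEnds t a b = ConsecPair t a b × ¬ T (isV4Sym a ∨ isV4Sym b)

  lastOf : Sym G ℓ → List (Sym G ℓ) → Sym G ℓ
  lastOf a []       = a
  lastOf a (b ∷ bs) = lastOf b bs

  degT : Sym G ℓ → Trace G ℓ → ℕ
  degT y []       = 0
  degT y (a ∷ as) =
    if any (symEq y) (a ∷ as)
    then (if symEq y a ∨ symEq y (lastOf a as) then 1 else 2)
    else 0

  sumDeg : List (Trace G ℓ) → Sym G ℓ → ℕ
  sumDeg 𝒯 y = sum (map (degT y) 𝒯)

  IsPattern : List (Trace G ℓ) → (Fin ℓ → ℕ) → Set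
  IsPattern 𝒯 d =
    All IsTrace 𝒯
    × (∀ x → 1 ≤ d x × d x ≤ 3)
    × (∀ (i j : Fin (length 𝒯)) → i ≢ j → ∀ a b → InEnds (lookup 𝒯 i) a b → ¬ InEnds (lookup 𝒯 j) a b)
    × (∀ (i j : Fin (length 𝒯)) → i ≢ j → ∀ a b → InEdges (lookup 𝒯 i) a b → ¬ InEdges (lookup 𝒯 j) a b)
    × (∀ u v → ((Adj G u v × T (isV4 G u ∨ isV4 G v)) → Any (λ t → InEdges t (inj₁ u) (inj₁ v)) 𝒯)
             × (Any (λ t → InEdges t (inj₁ u) (inj₁ v)) 𝒯 → (Adj G u v × T (isV4 G u ∨ isV4 G v))))
    × (∀ x → sumDeg 𝒯 (inj₂ x) ≤ d x)
    × (∀ v → T (inOpenN G v) → sumDeg 𝒯 (inj₁ v) ≤ deg G v)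

  Represents : (Fin ℓ → V G) → Sym G ℓ → V G → Set
  Represents f s v = (s ≡ inj₁ v × T (inClosedN G v)) ⊎ (∃[ x ] s ≡ inj₂ x × f x ≡ v)

  TraceOf : (V G → Bool) → (Fin ℓ → V G) → Trace G ℓ → Path G → Set
  TraceOf U f t p =
    Pointwise (Represents f) t (filterᵇ U (verts p))
    ⊎ Pointwise (Represents f) t (reverse (filterᵇ U (verts p)))

  Encodes : List (Trace G ℓ) → (Fin ℓ → ℕ) → List (Path G) → Set
  Encodes 𝒯 d Q =
    Σ (V G → Bool) λ U → IsTerminalCollection G Q U
    × Σ (Fin ℓ → V G) λ f →
        -- f is a bijection X_ℓ → V_X = U ∖ N[V₄]
        Injective _≡_ _≡_ f
        × (∀ x → T (U (f x)) × ¬ T (inClosedN G (f x)))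
        × (∀ v → T (U v) → ¬ T (inClosedN G v) → ∃[ x ] f x ≡ v)
        × Σ (Fin (length Q) ⤖ Fin (length 𝒯)) (λ σ →
            ∀ i → TraceOf U f (lookup 𝒯 (Bijection.to σ i)) (lookup Q i))
        × (∀ x → d x ≡ deg G (f x))

  gainV : List (Trace G ℓ) → V G → Bool
  gainV 𝒯 v = inClosedN G v ∧ not (isOdd (deg G v)) ∧ isOdd (sumDeg 𝒯 (inj₁ v))

  loseV : List (Trace G ℓ) → V G → Bool
  loseV 𝒯 v = inClosedN G v ∧ isOdd (deg G v) ∧ isOdd (sumDeg 𝒯 (inj₁ v))

  gainX : List (Trace G ℓ) → (Fin ℓ → ℕ) → Fin ℓ → Bool
  gainX 𝒯 d x = not (isOdd (d x)) ∧ isOdd (sumDeg 𝒯 (inj₂ x))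

  loseX : List (Trace G ℓ) → (Fin ℓ → ℕ) → Fin ℓ → Bool
  loseX 𝒯 d x = isOdd (d x) ∧ isOdd (sumDeg 𝒯 (inj₂ x))

  oddPattern : List (Trace G ℓ) → (Fin ℓ → ℕ) → ℤ
  oddPattern 𝒯 d =
    (+ (count (gainV 𝒯) (allFin n) + count (gainX 𝒯 d) (allFin ℓ)))
    - (+ (count (loseV 𝒯) (allFin n) + count (loseX 𝒯 d) (allFin ℓ)))

oddG : Graph → ℕ
oddG G = count (λ v → isOdd (deg G v)) (allFin (Graph.n G))

module Submission where

-- At every vertex v, deg v ≡ e(v) (mod 2), where e(v) is the number of ends at v of paths of P:
-- a path through v uses two edges at v, a path ending at v one. Write e = e₄ + e′, splitting the
-- paths by whether they visit V₄. Both ends of a path of P₄ lie in U and are the two ends of its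
-- trace, so a symbol representing v has Σ_T deg_T ≡ e₄(v) (mod 2). Hence v (or its symbol) gains
-- oddity iff deg v is even and e₄(v) odd, and loses it iff both are odd; in every case
-- [deg v odd] + [v gains] ≤ e′(v) + [v loses], because e′(v) ≡ deg v + e₄(v). A vertex carrying an
-- odd number of P₄-ends lies in U, where it is represented by exactly one symbol. Summing over all
-- vertices and using Σ e(v) = 2|P|, Σ e₄(v) = 2|P₄| = 2|𝒯| gives odd(G) + odd(𝒯,d) + 2|𝒯| ≤ 2|P|.

open import Defs

-- A module of its own, so that ℕ's operators do not clash with the ℤ ones in lemma21.
module PathEnds where
  open import Data.Bool using (Bool; true; false; T; _∧_; _∨_; not; _xor_; if_then_else_)
  open import Data.Bool.ListAction using (any)
  open import Data.Bool.Properties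
    using (T-≡; T-not-≡; T-∨; T-∧; xor-same; not-distribˡ-xor; ∨-zeroʳ; ∨-comm)
  open import Data.Empty using (⊥-elim)
  open import Data.Fin using (Fin; zero; suc)
  open import Data.Fin.Permutation using (↔⇒≡)
  open import Data.Fin.Properties using (_≟_)
  import Data.Integer as ℤ
  import Data.Integer.Properties as ℤ
  open import Data.Integer.Tactic.RingSolver renaming (solve-∀ to ℤ-solve-∀)
  open import Data.List
    using (List; []; _∷_; [_]; _++_; _∷ʳ_; length; filterᵇ; map; lookup; tabulate; reverse; allFin)
  open import Data.List.Membership.Propositional using (_∈_; lose)
  open import Data.List.Membership.Propositional.Properties using (∈-++⁺ʳ; ∈-lookup)
  open import Data.List.Properties using (unfold-reverse)
  open import Data.List.Relation.Binary.Pointwise using (Pointwise; []; _∷_)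
  import Data.List.Relation.Unary.All as All
  open import Data.List.Relation.Unary.All using (All; []; _∷_)
  open import Data.List.Relation.Unary.AllPairs using (_∷_)
  open import Data.List.Relation.Unary.Any using (here; there; index)
  open import Data.List.Relation.Unary.Any.Properties using (any⁺; lookup-index)
  open import Data.List.Relation.Unary.Linked as Linked using (Linked; _∷_)
  open import Data.List.Relation.Unary.Unique.Propositional using (Unique)
  open import Data.Nat using (ℕ; zero; suc; _+_; _*_; _≤_; z≤n; s≤s)
  open import Data.Nat.ListAction using (sum)
  open import Data.Nat.Properties
    using ( +-mono-≤; +-monoʳ-≤; m≤n⇒m≤n+o; m≤n+m; +-assoc; *-distribˡ-+; *-suc
          ; +-identityʳ; *-identityʳ; +-*-semiring)
  open import Data.Nat.Tactic.RingSolver using (solve-∀)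
  open import Data.Product using (∃; ∃₂; _×_; _,_; proj₂)
  open import Data.Sum as Sum using (_⊎_; inj₁; inj₂)
  open import Data.Sum.Properties using (≡-dec; inj₁-injective; inj₂-injective)
  open import Data.Unit using (tt)
  open import Function using (_∘_; id; Equivalence; _⇔_; mk⇔; _⤖_; Bijection)
  open import Function.Definitions using (Injective)
  open import Function.Properties.Bijection using (⤖⇒↔)
  open import Relation.Binary.Definitions using (DecidableEquality)
  open import Relation.Binary.PropositionalEquality hiding ([_])
  open import Relation.Nullary using (¬_; does; yes; no)
  open import Relation.Nullary.Decidable using (dec-true; does-⇔)
  open import Algebra.Properties.Semiring.Sum +-*-semiring
    using (sum-syntax; sum-cong-≗; sum-replicate-zero; ∑-distrib-+; ∑-comm; ∑-permute; *-distribʳ-sum)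

  open ≡-Reasoning
  open Equivalence using (to; from)

  -- Indicators and parity

  𝟙 : Bool → ℕ
  𝟙 true  = 1
  𝟙 false = 0

  ¬T⇒≡false : ∀ {b} → ¬ T b → b ≡ false
  ¬T⇒≡false {false} _  = refl
  ¬T⇒≡false {true}  ¬b = ⊥-elim (¬b tt)

  𝟙-∨ : ∀ x y → ¬ (T x × T y) → 𝟙 (x ∨ y) ≡ 𝟙 x + 𝟙 y
  𝟙-∨ true  true  ¬both = ⊥-elim (¬both (tt , tt))
  𝟙-∨ true  false _     = refl
  𝟙-∨ false _     _     = refl

  isOdd-+ : ∀ m n → isOdd (m + n) ≡ isOdd m xor isOdd n
  isOdd-+ zero    n = refl
  isOdd-+ (suc m) n = trans (cong not (isOdd-+ m n)) (not-distribˡ-xor (isOdd m) (isOdd n))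

  isOdd-2* : ∀ k → isOdd (2 * k) ≡ false
  isOdd-2* k = begin
    isOdd (k + (k + 0))   ≡⟨ cong (λ m → isOdd (k + m)) (+-identityʳ k) ⟩
    isOdd (k + k)         ≡⟨ isOdd-+ k k ⟩
    isOdd k xor isOdd k   ≡⟨ xor-same (isOdd k) ⟩
    false                 ∎

  isOdd-cancel : ∀ m n k → m + n ≡ 2 * k → isOdd m ≡ isOdd n
  isOdd-cancel m n k m+n≡2k = xor-≡false (begin
    isOdd m xor isOdd n   ≡⟨ isOdd-+ m n ⟨
    isOdd (m + n)         ≡⟨ cong isOdd m+n≡2k ⟩
    isOdd (2 * k)         ≡⟨ isOdd-2* k ⟩
    false                 ∎)
    where
    xor-≡false : ∀ {x y} → x xor y ≡ false → x ≡ y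
    xor-≡false {true}  {true}  _ = refl
    xor-≡false {false} {false} _ = refl

  isOdd-𝟙+𝟙 : ∀ x y → ¬ (T x × T y) → isOdd (𝟙 x + 𝟙 y) ≡ x ∨ y
  isOdd-𝟙+𝟙 true  true  ¬both = ⊥-elim (¬both (tt , tt))
  isOdd-𝟙+𝟙 true  false _     = refl
  isOdd-𝟙+𝟙 false true  _     = refl
  isOdd-𝟙+𝟙 false false _     = refl

  isOdd⇒1≤ : ∀ {e} → isOdd e ≡ true → 1 ≤ e
  isOdd⇒1≤ {suc _} _ = s≤s z≤n

  T-≟ : ∀ {n} {x y : Fin n} → T (does (x ≟ y)) ⇔ x ≡ y
  T-≟ {x = x} {y} with x ≟ y
  ... | yes x≡y = mk⇔ (λ _ → x≡y) (λ _ → tt)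
  ... | no  x≢y = mk⇔ (λ ()) x≢y

  -- Finite sums

  ∑-mono-≤ : ∀ {n} {f g : Fin n → ℕ} → (∀ i → f i ≤ g i) → ∑[ i < n ] f i ≤ ∑[ i < n ] g i
  ∑-mono-≤ {zero}  f≤g = z≤n
  ∑-mono-≤ {suc n} f≤g = +-mono-≤ (f≤g zero) (∑-mono-≤ (f≤g ∘ suc))

  ∑-isOdd-cong : ∀ {n} {f g : Fin n → ℕ} → (∀ i → isOdd (f i) ≡ isOdd (g i)) →
                 isOdd (∑[ i < n ] f i) ≡ isOdd (∑[ i < n ] g i)
  ∑-isOdd-cong {zero}          _  = refl
  ∑-isOdd-cong {suc n} {f} {g} eq = begin
    isOdd (f zero + ∑[ i < n ] f (suc i))             ≡⟨ isOdd-+ (f zero) _ ⟩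
    isOdd (f zero) xor isOdd (∑[ i < n ] f (suc i))   ≡⟨ cong₂ _xor_ (eq zero) (∑-isOdd-cong (eq ∘ suc)) ⟩
    isOdd (g zero) xor isOdd (∑[ i < n ] g (suc i))   ≡⟨ isOdd-+ (g zero) _ ⟨
    isOdd (g zero + ∑[ i < n ] g (suc i))             ∎

  ∑-δ : ∀ {n} (x : Fin n) (k : Fin n → ℕ) → ∑[ y < n ] (𝟙 (does (y ≟ x)) * k y) ≡ k x
  ∑-δ {suc n} zero    k = begin
    k zero + 0 + ∑[ y < n ] 0   ≡⟨ cong (k zero + 0 +_) (sum-replicate-zero n) ⟩
    k zero + 0 + 0              ≡⟨ trans (+-identityʳ (k zero + 0)) (+-identityʳ (k zero)) ⟩
    k zero                      ∎
  ∑-δ {suc n} (suc x) k = ∑-δ x (k ∘ suc)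

  ∑-𝟙-≟ : ∀ {n} (x : Fin n) → ∑[ y < n ] 𝟙 (does (y ≟ x)) ≡ 1
  ∑-𝟙-≟ {n} x =
    trans (sum-cong-≗ {n} (λ y → sym (*-identityʳ (𝟙 (does (y ≟ x)))))) (∑-δ x (λ _ → 1))

  ∑-𝟙-∧-≟ : ∀ {n} x (b : Fin n) → ∑[ u < n ] 𝟙 (x ∧ does (u ≟ b)) ≡ 𝟙 x
  ∑-𝟙-∧-≟     true  b = ∑-𝟙-≟ b
  ∑-𝟙-∧-≟ {n} false b = sum-replicate-zero n

  ∑-𝟙-≡1 : ∀ {n} {Q : Fin n → Bool} x → T (Q x) → (∀ y → T (Q y) → y ≡ x) →
           ∑[ y < n ] 𝟙 (Q y) ≡ 1
  ∑-𝟙-≡1 {Q = Q} x Qx only-x = trans (sum-cong-≗ (cong 𝟙 ∘ Q≡≟)) (∑-𝟙-≟ x)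
    where
    Q≡≟ : ∀ y → Q y ≡ does (y ≟ x)
    Q≡≟ y with y ≟ x
    ... | yes refl = to T-≡ Qx
    ... | no  y≢x  with Q y in Qy
    ...   | true  = ⊥-elim (y≢x (only-x y (from T-≡ Qy)))
    ...   | false = refl

  ∑-𝟙-≡0 : ∀ {n} {Q : Fin n → Bool} → (∀ y → ¬ T (Q y)) → ∑[ y < n ] 𝟙 (Q y) ≡ 0
  ∑-𝟙-≡0 {n} ¬Q = trans (sum-cong-≗ (cong 𝟙 ∘ ¬T⇒≡false ∘ ¬Q)) (sum-replicate-zero n)

  module _ {a b} {f : Fin a → Fin b} (f-injective : Injective _≡_ _≡_ f) {B : Fin b → Bool}
           (f-into : ∀ x → T (B (f x))) (f-onto : ∀ y → T (B y) → ∃ λ x → f x ≡ y) where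

    ∑-preimage : ∀ y → ∑[ x < a ] 𝟙 (does (y ≟ f x)) ≡ 𝟙 (B y)
    ∑-preimage y with B y in By
    ... | true  with f-onto y (from T-≡ By)
    ...   | x₀ , refl =
      ∑-𝟙-≡1 x₀ (from (T-≟ {x = f x₀}) refl) (λ x t → f-injective (sym (to (T-≟ {x = f x₀}) t)))
    ∑-preimage y | false =
      ∑-𝟙-≡0 (λ x t → subst T By (subst (T ∘ B) (sym (to (T-≟ {x = y}) t)) (f-into x)))

    ∑-image : ∀ (k : Fin b → ℕ) → ∑[ y < b ] (𝟙 (B y) * k y) ≡ ∑[ x < a ] k (f x)
    ∑-image k = begin
      ∑[ y < b ] (𝟙 (B y) * k y)
        ≡⟨ sum-cong-≗ {b} (λ y → cong (_* k y) (∑-preimage y)) ⟨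
      ∑[ y < b ] ((∑[ x < a ] 𝟙 (does (y ≟ f x))) * k y)
        ≡⟨ sum-cong-≗ {b} (λ y → *-distribʳ-sum {a} (k y) _) ⟩
      ∑[ y < b ] ∑[ x < a ] (𝟙 (does (y ≟ f x)) * k y)
        ≡⟨ ∑-comm {b} {a} (λ y x → 𝟙 (does (y ≟ f x)) * k y) ⟩
      ∑[ x < a ] ∑[ y < b ] (𝟙 (does (y ≟ f x)) * k y)
        ≡⟨ sum-cong-≗ {a} (λ x → ∑-δ (f x) k) ⟩
      ∑[ x < a ] k (f x)
        ∎

  count-∷ : ∀ {A : Set} (p : A → Bool) x xs → count p (x ∷ xs) ≡ 𝟙 (p x) + count p xs
  count-∷ p x xs with p x
  ... | true  = refl
  ... | false = refl

  count-tabulate : ∀ {A : Set} n (g : Fin n → A) (p : A → Bool) →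
                   count p (tabulate g) ≡ ∑[ i < n ] 𝟙 (p (g i))
  count-tabulate zero    g p = refl
  count-tabulate (suc n) g p =
    trans (count-∷ p (g zero) _) (cong (𝟙 (p (g zero)) +_) (count-tabulate n (g ∘ suc) p))

  sum-map-lookup : ∀ {A : Set} (g : A → ℕ) xs → sum (map g xs) ≡ ∑[ i < length xs ] g (lookup xs i)
  sum-map-lookup g []       = refl
  sum-map-lookup g (x ∷ xs) = cong (g x +_) (sum-map-lookup g xs)

  sum-map-filterᵇ : ∀ {A : Set} (g : A → ℕ) (q : A → Bool) xs →
                    sum (map g xs) ≡ sum (map g (filterᵇ q xs)) + sum (map g (filterᵇ (not ∘ q) xs))
  sum-map-filterᵇ g q []       = refl
  sum-map-filterᵇ g q (x ∷ xs) with q x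
  ... | true  = trans (cong (g x +_) (sum-map-filterᵇ g q xs)) (sym (+-assoc (g x) _ _))
  ... | false = trans (cong (g x +_) (sum-map-filterᵇ g q xs)) (+-left-comm (g x) (sum (map g (filterᵇ q xs))) _)
    where
    +-left-comm : ∀ l m n → l + (m + n) ≡ m + (l + n)
    +-left-comm = solve-∀

  -- Ends and consecutive pairs of lists

  last⁺ : {A : Set} → A → List A → A
  last⁺ a []       = a
  last⁺ _ (b ∷ bs) = last⁺ b bs

  module _ {A : Set} where

    last⁺∈ : ∀ (a : A) as → last⁺ a as ∈ a ∷ as
    last⁺∈ a []       = here refl
    last⁺∈ a (b ∷ bs) = there (last⁺∈ b bs)

    last⁺-∷ʳ : ∀ (c : A) cs a → last⁺ c (cs ∷ʳ a) ≡ a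
    last⁺-∷ʳ c []       a = refl
    last⁺-∷ʳ c (d ∷ cs) a = last⁺-∷ʳ d cs a

    ∷ʳ-last⁺ : ∀ (a : A) as → ∃ λ ys → a ∷ as ≡ ys ∷ʳ last⁺ a as
    ∷ʳ-last⁺ a []       = [] , refl
    ∷ʳ-last⁺ a (b ∷ bs) = let ys , eq = ∷ʳ-last⁺ b bs in a ∷ ys , cong (a ∷_) eq

    IsEndpoint-head : ∀ (a : A) as → IsEndpoint (a ∷ as) a
    IsEndpoint-head a as = inj₁ (as , refl)

    IsEndpoint-last⁺ : ∀ (a : A) as → IsEndpoint (a ∷ as) (last⁺ a as)
    IsEndpoint-last⁺ a as = inj₂ (∷ʳ-last⁺ a as)

    reverse-∷ : ∀ (a : A) as →
                ∃₂ λ c cs → reverse (a ∷ as) ≡ c ∷ cs × c ≡ last⁺ a as × last⁺ c cs ≡ a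
    reverse-∷ a []       = a , [] , refl , refl , refl
    reverse-∷ a (b ∷ bs) with reverse-∷ b bs
    ... | c , cs , rev , refl , _ =
      c , cs ∷ʳ a , trans (unfold-reverse a (b ∷ bs)) (cong (_∷ʳ a) rev) , refl , last⁺-∷ʳ c cs a

    last⁺-filterᵇ : ∀ (U : A → Bool) a b bs → T (U (last⁺ b bs)) →
                    last⁺ a (filterᵇ U (b ∷ bs)) ≡ last⁺ b bs
    last⁺-filterᵇ U a b []       Ub with U b
    ... | true = refl
    last⁺-filterᵇ U a b (c ∷ cs) Uℓ with U b
    ... | true  = last⁺-filterᵇ U b c cs Uℓ
    ... | false = last⁺-filterᵇ U a c cs Uℓ

    last⁺-Pointwise : ∀ {B : Set} {R : A → B → Set} {c cs a as} →
                      Pointwise R (c ∷ cs) (a ∷ as) → R (last⁺ c cs) (last⁺ a as)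
    last⁺-Pointwise (r ∷ [])         = r
    last⁺-Pointwise (_ ∷ rs@(_ ∷ _)) = last⁺-Pointwise rs

    ConsecPair-∷ : ∀ c {ws : List A} {v u} → ConsecPair ws v u → ConsecPair (c ∷ ws) v u
    ConsecPair-∷ c = Sum.map prepend prepend
      where
      prepend : ∀ {ws : List A} {v u} → Consec ws v u → Consec (c ∷ ws) v u
      prepend (as , bs , eq) = c ∷ as , bs , cong (c ∷_) eq

    Consec⇒∈ : ∀ {ws : List A} {v u} → Consec ws v u → v ∈ ws × u ∈ ws
    Consec⇒∈ (as , _ , refl) = ∈-++⁺ʳ as (here refl) , ∈-++⁺ʳ as (there (here refl))

    ConsecPair⇒∈ : ∀ {ws : List A} {v u} → ConsecPair ws v u → v ∈ ws × u ∈ ws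
    ConsecPair⇒∈ (inj₁ vu) = Consec⇒∈ vu
    ConsecPair⇒∈ (inj₂ uv) = let u∈ , v∈ = Consec⇒∈ uv in v∈ , u∈

    Linked-Consec : ∀ {R : A → A → Set} {ws v u} → Linked R ws → Consec ws v u → R v u
    Linked-Consec {R} linked (as , bs , refl) = go as linked
      where
      go : ∀ as {v u} → Linked R (as ++ v ∷ u ∷ bs) → R v u
      go []       (vu ∷ _) = vu
      go (_ ∷ as) linked   = go as (Linked.tail linked)

  module _ {A : Set} (_≟ᴬ_ : DecidableEquality A) where

    isEnd : A → List A → Bool
    isEnd y []       = false
    isEnd y (a ∷ as) = does (y ≟ᴬ a) ∨ does (y ≟ᴬ last⁺ a as)

    isEnd⇒any : ∀ y xs → T (isEnd y xs) → T (any (λ a → does (y ≟ᴬ a)) xs)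
    isEnd⇒any y (a ∷ as) end with to (T-∨ {does (y ≟ᴬ a)}) end
    ... | inj₁ y≡a = any⁺ (λ a → does (y ≟ᴬ a)) (here {xs = as} y≡a)
    ... | inj₂ y≡ℓ = any⁺ (λ a → does (y ≟ᴬ a)) (lose (last⁺∈ a as) y≡ℓ)

    isEnd-reverse : ∀ y xs → isEnd y (reverse xs) ≡ isEnd y xs
    isEnd-reverse y []       = refl
    isEnd-reverse y (a ∷ as) with reverse-∷ a as
    ... | c , cs , rev , refl , last≡a rewrite rev | last≡a = ∨-comm (does (y ≟ᴬ last⁺ a as)) _

    isEnd-filterᵇ : ∀ (U : A → Bool) y a as → T (U a) → T (U (last⁺ a as)) →
                    isEnd y (filterᵇ U (a ∷ as)) ≡ isEnd y (a ∷ as)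
    isEnd-filterᵇ U y a []       Ua _  with U a
    ... | true = refl
    isEnd-filterᵇ U y a (b ∷ bs) Ua Uℓ with U a
    ... | true = cong (λ z → does (y ≟ᴬ a) ∨ does (y ≟ᴬ z)) (last⁺-filterᵇ U a b bs Uℓ)

  isEnd-Pointwise : ∀ {A B : Set} (_≟ᴬ_ : DecidableEquality A) (_≟ᴮ_ : DecidableEquality B)
    {R : A → B → Set} → (∀ {s s′ v v′} → R s v → R s′ v′ → s ≡ s′ ⇔ v ≡ v′) →
    ∀ {s v t ws} → R s v → Pointwise R t ws → isEnd _≟ᴬ_ s t ≡ isEnd _≟ᴮ_ v ws
  isEnd-Pointwise _≟ᴬ_ _≟ᴮ_ R-≡ sRv [] = refl
  isEnd-Pointwise _≟ᴬ_ _≟ᴮ_ R-≡ {s} {v} {c ∷ cs} {a ∷ as} sRv rs@(cRa ∷ _) = cong₂ _∨_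
    (does-⇔ (R-≡ sRv cRa) (s ≟ᴬ c) (v ≟ᴮ a))
    (does-⇔ (R-≡ sRv (last⁺-Pointwise rs)) (s ≟ᴬ last⁺ c cs) (v ≟ᴮ last⁺ a as))

  -- Walks on Fin n

  module _ {n : ℕ} where

    joins : Fin n → Fin n → Fin n → Fin n → Bool
    joins a b v u = (does (v ≟ a) ∧ does (u ≟ b)) ∨ (does (v ≟ b) ∧ does (u ≟ a))

    adjacentIn : List (Fin n) → Fin n → Fin n → Bool
    adjacentIn (a ∷ b ∷ ws) v u = joins a b v u ∨ adjacentIn (b ∷ ws) v u
    adjacentIn _            _ _ = false

    endsAt : Fin n → List (Fin n) → ℕ
    endsAt v []       = 0
    endsAt v (a ∷ as) = 𝟙 (does (v ≟ a)) + 𝟙 (does (v ≟ last⁺ a as))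

    joins⇒ : ∀ {a b v u} → T (joins a b v u) → (v ≡ a × u ≡ b) ⊎ (v ≡ b × u ≡ a)
    joins⇒ {a} {b} {v} {u} j = Sum.map both both (to (T-∨ {does (v ≟ a) ∧ does (u ≟ b)}) j)
      where
      both : ∀ {x y z w : Fin n} → T (does (x ≟ y) ∧ does (z ≟ w)) → x ≡ y × z ≡ w
      both {x} {y} t = let t₁ , t₂ = to (T-∧ {does (x ≟ y)}) t in to T-≟ t₁ , to T-≟ t₂

    joins-refl : ∀ a b → T (joins a b a b)
    joins-refl a b rewrite dec-true (a ≟ a) refl | dec-true (b ≟ b) refl = tt

    joins-flip : ∀ a b → T (joins a b b a)
    joins-flip a b rewrite dec-true (a ≟ a) refl | dec-true (b ≟ b) refl =
      subst T (sym (∨-zeroʳ (does (b ≟ a) ∧ does (a ≟ b)))) tt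

    adjacentIn-∷ : ∀ c ws {v u} → T (adjacentIn ws v u) → T (adjacentIn (c ∷ ws) v u)
    adjacentIn-∷ c (a ∷ _) {v} {u} t = from (T-∨ {joins c a v u}) (inj₂ t)

    adjacentIn-++ : ∀ as {a b bs v u} → T (joins a b v u) → T (adjacentIn (as ++ a ∷ b ∷ bs) v u)
    adjacentIn-++ []                             j = from T-∨ (inj₁ j)
    adjacentIn-++ (c ∷ as) {a} {b} {bs} {v} {u} j = adjacentIn-∷ c (as ++ a ∷ b ∷ bs) (adjacentIn-++ as j)

    ConsecPair⇒adjacentIn : ∀ {ws v u} → ConsecPair ws v u → T (adjacentIn ws v u)
    ConsecPair⇒adjacentIn {v = v} {u} (inj₁ (as , _ , refl)) = adjacentIn-++ as (joins-refl v u)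
    ConsecPair⇒adjacentIn {v = v} {u} (inj₂ (as , _ , refl)) = adjacentIn-++ as (joins-flip u v)

    adjacentIn⇒ConsecPair : ∀ ws {v u} → T (adjacentIn ws v u) → ConsecPair ws v u
    adjacentIn⇒ConsecPair (a ∷ b ∷ ws) {v} {u} t =
      Sum.[ first , ConsecPair-∷ a ∘ adjacentIn⇒ConsecPair (b ∷ ws) ] (to (T-∨ {joins a b v u}) t)
      where
      first : T (joins a b v u) → ConsecPair (a ∷ b ∷ ws) v u
      first j with joins⇒ {a} {b} {v} {u} j
      ... | inj₁ (refl , refl) = inj₁ ([] , ws , refl)
      ... | inj₂ (refl , refl) = inj₂ ([] , ws , refl)

    adjacentIn⇒∈ : ∀ ws {v u} → T (adjacentIn ws v u) → v ∈ ws × u ∈ ws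
    adjacentIn⇒∈ ws = ConsecPair⇒∈ ∘ adjacentIn⇒ConsecPair ws

    ∑-joins : ∀ {a b} → a ≢ b → ∀ v →
              ∑[ u < n ] 𝟙 (joins a b v u) ≡ 𝟙 (does (v ≟ a)) + 𝟙 (does (v ≟ b))
    ∑-joins {a} {b} a≢b v = begin
      ∑[ u < n ] 𝟙 (joins a b v u)
        ≡⟨ sum-cong-≗ {n} (λ u → 𝟙-∨ _ _ (exclusive u)) ⟩
      ∑[ u < n ] (𝟙 (does (v ≟ a) ∧ does (u ≟ b)) + 𝟙 (does (v ≟ b) ∧ does (u ≟ a)))
        ≡⟨ ∑-distrib-+ {n} (λ u → 𝟙 (does (v ≟ a) ∧ does (u ≟ b))) _ ⟩
      ∑[ u < n ] 𝟙 (does (v ≟ a) ∧ does (u ≟ b)) + ∑[ u < n ] 𝟙 (does (v ≟ b) ∧ does (u ≟ a))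
        ≡⟨ cong₂ _+_ (∑-𝟙-∧-≟ (does (v ≟ a)) b) (∑-𝟙-∧-≟ (does (v ≟ b)) a) ⟩
      𝟙 (does (v ≟ a)) + 𝟙 (does (v ≟ b))
        ∎
      where
      exclusive : ∀ u → ¬ (T (does (v ≟ a) ∧ does (u ≟ b)) × T (does (v ≟ b) ∧ does (u ≟ a)))
      exclusive u (t₁ , t₂) with v ≟ a | v ≟ b
      ... | yes refl | yes refl = a≢b refl
      ... | no _     | _        = t₁
      ... | yes _    | no _     = t₂

    -- An interior occurrence of v has two neighbours along ws, an end occurrence one.
    ∑-adjacentIn+endsAt : ∀ {ws} → Unique ws → ∀ v →
      ∑[ u < n ] 𝟙 (adjacentIn ws v u) + endsAt v ws ≡ 2 * count (λ a → does (v ≟ a)) ws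
    ∑-adjacentIn+endsAt {[]}     _ v = trans (+-identityʳ (∑[ u < n ] 0)) (sum-replicate-zero n)
    ∑-adjacentIn+endsAt {a ∷ []} _ v = begin
      ∑[ u < n ] 0 + (va + va)            ≡⟨ cong (_+ (va + va)) (sum-replicate-zero n) ⟩
      va + va                             ≡⟨ double va ⟩
      2 * (va + 0)                        ≡⟨ cong (2 *_) (count-∷ (λ a → does (v ≟ a)) a []) ⟨
      2 * count (λ a → does (v ≟ a)) [ a ] ∎
      where
      va = 𝟙 (does (v ≟ a))
      double : ∀ x → x + x ≡ 2 * (x + 0)
      double = solve-∀
    ∑-adjacentIn+endsAt {a ∷ b ∷ ws} (a∉ ∷ unique) v = begin
      ∑[ u < n ] 𝟙 (joins a b v u ∨ adjacentIn (b ∷ ws) v u) + (va + vℓ)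
        ≡⟨ cong (_+ (va + vℓ)) (sum-cong-≗ {n} (λ u → 𝟙-∨ _ _ (exclusive u))) ⟩
      ∑[ u < n ] (𝟙 (joins a b v u) + 𝟙 (adjacentIn (b ∷ ws) v u)) + (va + vℓ)
        ≡⟨ cong (_+ (va + vℓ)) (∑-distrib-+ {n} (λ u → 𝟙 (joins a b v u)) _) ⟩
      ∑[ u < n ] 𝟙 (joins a b v u) + S + (va + vℓ)
        ≡⟨ cong (λ m → m + S + (va + vℓ)) (∑-joins (All.head a∉) v) ⟩
      va + vb + S + (va + vℓ)
        ≡⟨ shuffle va vb vℓ S ⟩
      2 * va + (S + (vb + vℓ))
        ≡⟨ cong (2 * va +_) (∑-adjacentIn+endsAt unique v) ⟩
      2 * va + 2 * count (λ a → does (v ≟ a)) (b ∷ ws)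
        ≡⟨ *-distribˡ-+ 2 va _ ⟨
      2 * (va + count (λ a → does (v ≟ a)) (b ∷ ws))
        ≡⟨ cong (2 *_) (count-∷ (λ a → does (v ≟ a)) a (b ∷ ws)) ⟨
      2 * count (λ a → does (v ≟ a)) (a ∷ b ∷ ws)
        ∎
      where
      va = 𝟙 (does (v ≟ a))
      vb = 𝟙 (does (v ≟ b))
      vℓ = 𝟙 (does (v ≟ last⁺ b ws))
      S  = ∑[ u < n ] 𝟙 (adjacentIn (b ∷ ws) v u)
      shuffle : ∀ x y z s → x + y + s + (x + z) ≡ 2 * x + (s + (y + z))
      shuffle = solve-∀
      exclusive : ∀ u → ¬ (T (joins a b v u) × T (adjacentIn (b ∷ ws) v u))
      exclusive u (j , t) with joins⇒ {a} {b} {v} {u} j | adjacentIn⇒∈ (b ∷ ws) t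
      ... | inj₁ (refl , _) | v∈ , _ = All.lookup a∉ v∈ refl
      ... | inj₂ (_ , refl) | _ , u∈ = All.lookup a∉ u∈ refl

    isOdd-∑-adjacentIn : ∀ {ws} → Unique ws → ∀ v →
      isOdd (∑[ u < n ] 𝟙 (adjacentIn ws v u)) ≡ isOdd (endsAt v ws)
    isOdd-∑-adjacentIn {ws} unique v =
      isOdd-cancel (∑[ u < n ] 𝟙 (adjacentIn ws v u)) (endsAt v ws) (count (λ a → does (v ≟ a)) ws)
        (∑-adjacentIn+endsAt unique v)

    ∑-endsAt : ∀ a as → ∑[ v < n ] endsAt v (a ∷ as) ≡ 2
    ∑-endsAt a as = trans (∑-distrib-+ {n} (λ v → 𝟙 (does (v ≟ a))) _)
                          (cong₂ _+_ (∑-𝟙-≟ a) (∑-𝟙-≟ (last⁺ a as)))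

    isOdd-endsAt : ∀ {a b bs} → Unique (a ∷ b ∷ bs) → ∀ v →
                   isOdd (endsAt v (a ∷ b ∷ bs)) ≡ isEnd _≟_ v (a ∷ b ∷ bs)
    isOdd-endsAt {a} {b} {bs} (a∉ ∷ _) v = isOdd-𝟙+𝟙 _ _ distinct-ends
      where
      distinct-ends : ¬ (T (does (v ≟ a)) × T (does (v ≟ last⁺ b bs)))
      distinct-ends (t₁ , t₂) with v ≟ a | v ≟ last⁺ b bs
      ... | yes refl | yes v≡ℓ = All.lookup a∉ (last⁺∈ b bs) v≡ℓ

    endsAt-outside : ∀ {U : Fin n → Bool} {v} ws → ¬ T (U v) → (∀ w → IsEndpoint ws w → T (U w)) →
                     endsAt v ws ≡ 0
    endsAt-outside         []       _   _         = refl
    endsAt-outside {v = v} (a ∷ as) ¬Uv ends-in-U with v ≟ a | v ≟ last⁺ a as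
    ... | yes refl | _        = ⊥-elim (¬Uv (ends-in-U a (IsEndpoint-head a as)))
    ... | no _     | yes refl = ⊥-elim (¬Uv (ends-in-U v (IsEndpoint-last⁺ a as)))
    ... | no _     | no _     = refl

  -- Path partitions

  module _ (G : Graph) where
    open Graph G using (n; adj)

    EndpointsIn : (V G → Bool) → Path G → Set
    EndpointsIn U p = ∀ v → IsEndpoint (verts p) v → T (U v)

    endsIn : List (Path G) → V G → ℕ
    endsIn Q v = sum (map (λ p → endsAt v (verts p)) Q)

    adjacentIn⇒Adj : ∀ {ws v u} → Linked (Adj G) ws → T (adjacentIn ws v u) → Adj G v u
    adjacentIn⇒Adj {ws} {v} {u} linked t with adjacentIn⇒ConsecPair ws t
    ... | inj₁ vu = Linked-Consec linked vu
    ... | inj₂ uv = subst T (Graph.sym G u v) (Linked-Consec linked uv)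

    𝟙-adj≡∑-adjacentIn : ∀ {P} → IsPathPartition G P → ∀ v u →
      𝟙 (adj v u) ≡ ∑[ i < length P ] 𝟙 (adjacentIn (verts (lookup P i)) v u)
    𝟙-adj≡∑-adjacentIn {P} (disjoint , covers) v u with adj v u in uv
    ... | true  = sym (∑-𝟙-≡1 i (ConsecPair⇒adjacentIn (lookup-index cover)) only-i)
      where
      cover = covers v u (from T-≡ uv)
      i = index cover
      only-i : ∀ j → T (adjacentIn (verts (lookup P j)) v u) → j ≡ i
      only-i j t with j ≟ i
      ... | yes j≡i = j≡i
      ... | no  j≢i = ⊥-elim (disjoint j i j≢i v u (adjacentIn⇒ConsecPair _ t) (lookup-index cover))
    ... | false = sym (∑-𝟙-≡0 (λ i t → subst T uv (adjacentIn⇒Adj (linked (lookup P i)) t)))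

    isOdd-deg : ∀ {P} → IsPathPartition G P → ∀ v → isOdd (deg G v) ≡ isOdd (endsIn P v)
    isOdd-deg {P} partition v = begin
      isOdd (deg G v)
        ≡⟨ cong isOdd (count-tabulate n id (adj v)) ⟩
      isOdd (∑[ u < n ] 𝟙 (adj v u))
        ≡⟨ cong isOdd (sum-cong-≗ {n} (𝟙-adj≡∑-adjacentIn partition v)) ⟩
      isOdd (∑[ u < n ] ∑[ i < length P ] 𝟙 (adjacentIn (path i) v u))
        ≡⟨ cong isOdd (∑-comm {n} {length P} _) ⟩
      isOdd (∑[ i < length P ] ∑[ u < n ] 𝟙 (adjacentIn (path i) v u))
        ≡⟨ ∑-isOdd-cong (λ i → isOdd-∑-adjacentIn (unique (lookup P i)) v) ⟩
      isOdd (∑[ i < length P ] endsAt v (path i))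
        ≡⟨ cong isOdd (sum-map-lookup (λ p → endsAt v (verts p)) P) ⟨
      isOdd (endsIn P v)
        ∎
      where
      path : Fin (length P) → List (V G)
      path i = verts (lookup P i)

    ∑-endsIn : ∀ Q → ∑[ v < n ] endsIn Q v ≡ 2 * length Q
    ∑-endsIn []      = sum-replicate-zero n
    ∑-endsIn (p ∷ Q) = begin
      ∑[ v < n ] (endsAt v (verts p) + endsIn Q v)            ≡⟨ ∑-distrib-+ {n} (λ v → endsAt v (verts p)) _ ⟩
      ∑[ v < n ] endsAt v (verts p) + ∑[ v < n ] endsIn Q v   ≡⟨ cong₂ _+_ (∑-endsAt-Path p) (∑-endsIn Q) ⟩
      2 + 2 * length Q                                        ≡⟨ *-suc 2 (length Q) ⟨
      2 * length (p ∷ Q)                                      ∎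
      where
      ∑-endsAt-Path : ∀ p → ∑[ v < n ] endsAt v (verts p) ≡ 2
      ∑-endsAt-Path p with verts p | nontriv p
      ... | a ∷ as | _ = ∑-endsAt a as

    endsIn-outside : ∀ {U v} Q → ¬ T (U v) → All (EndpointsIn U) Q → endsIn Q v ≡ 0
    endsIn-outside []      _   []       = refl
    endsIn-outside (p ∷ Q) ¬Uv (e ∷ es) = cong₂ _+_ (endsAt-outside (verts p) ¬Uv e) (endsIn-outside Q ¬Uv es)

    odd-endsIn⇒∈U : ∀ {U v} Q → All (EndpointsIn U) Q → T (isOdd (endsIn Q v)) → T (U v)
    odd-endsIn⇒∈U {U} {v} Q ends-in-U odd with U v in Uv
    ... | true  = tt
    ... | false = subst (T ∘ isOdd) (endsIn-outside Q (subst T Uv) ends-in-U) odd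

  -- Traces

  module _ (G : Graph) (ℓ : ℕ) where

    _≟ˢ_ : DecidableEquality (Sym G ℓ)
    _≟ˢ_ = ≡-dec _≟_ _≟_

    lastOf≡last⁺ : ∀ a as → lastOf G ℓ a as ≡ last⁺ a as
    lastOf≡last⁺ a []       = refl
    lastOf≡last⁺ a (b ∷ bs) = lastOf≡last⁺ b bs

    isOdd-degT : ∀ y t → isOdd (degT G ℓ y t) ≡ isEnd _≟ˢ_ y t
    isOdd-degT y []       = refl
    isOdd-degT y (a ∷ as) with any (symEq G ℓ y) (a ∷ as) in occurs
    ... | true  = trans (isOdd-if (symEq G ℓ y a ∨ symEq G ℓ y (lastOf G ℓ a as)))
                        (cong (λ z → symEq G ℓ y a ∨ symEq G ℓ y z) (lastOf≡last⁺ a as))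
      where
      isOdd-if : ∀ b → isOdd (if b then 1 else 2) ≡ b
      isOdd-if true  = refl
      isOdd-if false = refl
    ... | false = sym (¬T⇒≡false (λ end → subst T occurs (isEnd⇒any _≟ˢ_ y (a ∷ as) end)))

    module _ (U : V G → Bool) (f : Fin ℓ → V G) (f-injective : Injective _≡_ _≡_ f)
             (f-outside : ∀ x → ¬ T (inClosedN G (f x))) where

      Represents-≡ : ∀ {s s′ v v′} → Represents G ℓ f s v → Represents G ℓ f s′ v′ → s ≡ s′ ⇔ v ≡ v′
      Represents-≡ (inj₁ (refl , _)) (inj₁ (refl , _)) = mk⇔ inj₁-injective (cong inj₁)
      Represents-≡ (inj₁ (refl , v∈N)) (inj₂ (x , refl , refl)) =
        mk⇔ (λ ()) (λ { refl → ⊥-elim (f-outside x v∈N) })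
      Represents-≡ (inj₂ (x , refl , refl)) (inj₁ (refl , v∈N)) =
        mk⇔ (λ ()) (λ { refl → ⊥-elim (f-outside x v∈N) })
      Represents-≡ (inj₂ (x , refl , refl)) (inj₂ (y , refl , refl)) =
        mk⇔ (cong f ∘ inj₂-injective) (cong inj₂ ∘ f-injective)

      isOdd-degT-trace : ∀ {t s v} ws → Unique ws → 2 ≤ length ws → (∀ w → IsEndpoint ws w → T (U w)) →
        Pointwise (Represents G ℓ f) t (filterᵇ U ws) ⊎ Pointwise (Represents G ℓ f) t (reverse (filterᵇ U ws)) →
        Represents G ℓ f s v → isOdd (degT G ℓ s t) ≡ isOdd (endsAt v ws)
      isOdd-degT-trace (_ ∷ []) _ (s≤s ()) _ _ _
      isOdd-degT-trace {t} {s} {v} ws@(a ∷ b ∷ bs) unique _ ends-in-U trace sRv = begin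
        isOdd (degT G ℓ s t)         ≡⟨ isOdd-degT s t ⟩
        isEnd _≟ˢ_ s t               ≡⟨ isEnd-trace trace ⟩
        isEnd _≟_ v (filterᵇ U ws)   ≡⟨ isEnd-filterᵇ _≟_ U v a (b ∷ bs)
                                          (ends-in-U a (IsEndpoint-head a (b ∷ bs)))
                                          (ends-in-U _ (IsEndpoint-last⁺ a (b ∷ bs))) ⟩
        isEnd _≟_ v ws               ≡⟨ isOdd-endsAt unique v ⟨
        isOdd (endsAt v ws)          ∎
        where
        isEnd-trace : _ → isEnd _≟ˢ_ s t ≡ isEnd _≟_ v (filterᵇ U ws)
        isEnd-trace (inj₁ pw) = isEnd-Pointwise _≟ˢ_ _≟_ Represents-≡ sRv pw
        isEnd-trace (inj₂ pw) =
          trans (isEnd-Pointwise _≟ˢ_ _≟_ Represents-≡ sRv pw) (isEnd-reverse _≟_ v (filterᵇ U ws))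

      isOdd-sumDeg : ∀ {𝒯 Q} (σ : Fin (length Q) ⤖ Fin (length 𝒯)) →
        (∀ i → TraceOf G ℓ U f (lookup 𝒯 (Bijection.to σ i)) (lookup Q i)) → All (EndpointsIn G U) Q →
        ∀ {s v} → Represents G ℓ f s v → isOdd (sumDeg G ℓ 𝒯 s) ≡ isOdd (endsIn G Q v)
      isOdd-sumDeg {𝒯} {Q} σ traces ends-in-U {s} {v} sRv = begin
        isOdd (sum (map (degT G ℓ s) 𝒯))
          ≡⟨ cong isOdd (sum-map-lookup (degT G ℓ s) 𝒯) ⟩
        isOdd (∑[ j < length 𝒯 ] degT G ℓ s (lookup 𝒯 j))
          ≡⟨ cong isOdd (∑-permute _ (⤖⇒↔ σ)) ⟩
        isOdd (∑[ i < length Q ] degT G ℓ s (lookup 𝒯 (Bijection.to σ i)))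
          ≡⟨ ∑-isOdd-cong trace-parity ⟩
        isOdd (∑[ i < length Q ] endsAt v (verts (lookup Q i)))
          ≡⟨ cong isOdd (sum-map-lookup (λ p → endsAt v (verts p)) Q) ⟨
        isOdd (endsIn G Q v)
          ∎
        where
        trace-parity : ∀ i → isOdd (degT G ℓ s (lookup 𝒯 (Bijection.to σ i)))
                           ≡ isOdd (endsAt v (verts (lookup Q i)))
        trace-parity i = let p = lookup Q i in
          isOdd-degT-trace (verts p) (unique p) (nontriv p) (All.lookup ends-in-U (∈-lookup i)) (traces i) sRv

  -- Counting oddities

  oddity-balance : ∀ o s e → o ≡ s xor isOdd e → 𝟙 o + 𝟙 (not o ∧ s) ≤ e + 𝟙 (o ∧ s)
  oddity-balance _ s e refl with s | isOdd e in odd-e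
  ... | true  | true  = m≤n⇒m≤n+o 0 (isOdd⇒1≤ odd-e)
  ... | true  | false = m≤n+m 1 e
  ... | false | true  = m≤n⇒m≤n+o 0 (isOdd⇒1≤ odd-e)
  ... | false | false = z≤n

  𝟙-split : ∀ c u w → (T w → T u) → 𝟙 (c ∧ w) + 𝟙 (u ∧ not c) * 𝟙 w ≡ 𝟙 w
  𝟙-split true  true  true  _   = refl
  𝟙-split true  true  false _   = refl
  𝟙-split true  false true  _   = refl
  𝟙-split true  false false _   = refl
  𝟙-split false true  true  _   = refl
  𝟙-split false true  false _   = refl
  𝟙-split false false true  w⇒u = ⊥-elim (w⇒u tt)
  𝟙-split false false false _   = refl

  ℤ-bound : ∀ a g l e c {b} → a + g ≤ e + l → b ≡ c + e →
            (ℤ.+ a ℤ.+ (ℤ.+ g ℤ.- ℤ.+ l)) ℤ.+ ℤ.+ c ℤ.≤ ℤ.+ b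
  ℤ-bound a g l e c a+g≤e+l refl =
    subst₂ ℤ._≤_ (lhs (ℤ.+ a) (ℤ.+ g) (ℤ.+ l) (ℤ.+ c)) (rhs (ℤ.+ c) (ℤ.+ e) (ℤ.+ l))
      (ℤ.+-monoˡ-≤ (ℤ.- ℤ.+ l) (ℤ.+≤+ (+-monoʳ-≤ c a+g≤e+l)))
    where
    lhs : ∀ A G L C → C ℤ.+ (A ℤ.+ G) ℤ.+ ℤ.- L ≡ A ℤ.+ (G ℤ.- L) ℤ.+ C
    lhs = ℤ-solve-∀
    rhs : ∀ C E L → C ℤ.+ (E ℤ.+ L) ℤ.+ ℤ.- L ≡ C ℤ.+ E
    rhs = ℤ-solve-∀

  module Counting (G : Graph) (P : List (Path G)) (partition : IsPathPartition G P)
    (ℓ : ℕ) (𝒯 : List (Trace G ℓ)) (d : Fin ℓ → ℕ) (U : V G → Bool)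
    (ends-in-U : All (EndpointsIn G U) (P4 G P))
    (f : Fin ℓ → V G) (f-injective : Injective _≡_ _≡_ f)
    (f-into : ∀ x → T (U (f x)) × ¬ T (inClosedN G (f x)))
    (f-onto : ∀ v → T (U v) → ¬ T (inClosedN G v) → ∃ λ x → f x ≡ v)
    (σ : Fin (length (P4 G P)) ⤖ Fin (length 𝒯))
    (traces : ∀ i → TraceOf G ℓ U f (lookup 𝒯 (Bijection.to σ i)) (lookup (P4 G P) i))
    (d≡deg : ∀ x → d x ≡ deg G (f x)) where

    open Graph G using (n)

    P₄ P′ : List (Path G)
    P₄ = P4 G P
    P′ = filterᵇ (not ∘ visitsV4 G) P

    odd oddEnds inVX : V G → Bool
    odd v     = isOdd (deg G v)
    oddEnds v = isOdd (endsIn G P₄ v)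
    inVX v    = U v ∧ not (inClosedN G v)

    f∈VX : ∀ x → T (inVX (f x))
    f∈VX x = let Ufx , fx∉N = f-into x in from T-∧ (Ufx , from T-not-≡ (¬T⇒≡false fx∉N))

    VX⊆f : ∀ v → T (inVX v) → ∃ λ x → f x ≡ v
    VX⊆f v v∈VX = let Uv , v∉N = to (T-∧ {U v}) v∈VX in
      f-onto v Uv (λ v∈N → subst T (to T-not-≡ v∉N) v∈N)

    isOdd-sumDeg-𝒯 : ∀ {s v} → Represents G ℓ f s v → isOdd (sumDeg G ℓ 𝒯 s) ≡ oddEnds v
    isOdd-sumDeg-𝒯 = isOdd-sumDeg G ℓ U f f-injective (proj₂ ∘ f-into) {𝒯} σ traces ends-in-U

    endsIn-split : ∀ v → endsIn G P v ≡ endsIn G P₄ v + endsIn G P′ v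
    endsIn-split v = sum-map-filterᵇ (λ p → endsAt v (verts p)) (visitsV4 G) P

    odd-split : ∀ v → odd v ≡ oddEnds v xor isOdd (endsIn G P′ v)
    odd-split v = begin
      odd v                                   ≡⟨ isOdd-deg G partition v ⟩
      isOdd (endsIn G P v)                    ≡⟨ cong isOdd (endsIn-split v) ⟩
      isOdd (endsIn G P₄ v + endsIn G P′ v)   ≡⟨ isOdd-+ (endsIn G P₄ v) _ ⟩
      oddEnds v xor isOdd (endsIn G P′ v)     ∎

    oddity-count : ∀ (φ : Bool → Bool) →
      count (λ v → inClosedN G v ∧ φ (odd v) ∧ isOdd (sumDeg G ℓ 𝒯 (inj₁ v))) (allFin n)
        + count (λ x → φ (isOdd (d x)) ∧ isOdd (sumDeg G ℓ 𝒯 (inj₂ x))) (allFin ℓ)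
      ≡ ∑[ v < n ] 𝟙 (φ (odd v) ∧ oddEnds v)
    oddity-count φ = begin
      count (λ v → inClosedN G v ∧ φ (odd v) ∧ isOdd (sumDeg G ℓ 𝒯 (inj₁ v))) (allFin n)
        + count (λ x → φ (isOdd (d x)) ∧ isOdd (sumDeg G ℓ 𝒯 (inj₂ x))) (allFin ℓ)
        ≡⟨ cong₂ _+_ (count-tabulate n id _) (count-tabulate ℓ id _) ⟩
      ∑[ v < n ] 𝟙 (inClosedN G v ∧ φ (odd v) ∧ isOdd (sumDeg G ℓ 𝒯 (inj₁ v)))
        + ∑[ x < ℓ ] 𝟙 (φ (isOdd (d x)) ∧ isOdd (sumDeg G ℓ 𝒯 (inj₂ x)))
        ≡⟨ cong₂ _+_ (sum-cong-≗ {n} vertex-symbol) (sum-cong-≗ {ℓ} variable-symbol) ⟩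
      ∑[ v < n ] 𝟙 (inClosedN G v ∧ w v) + ∑[ x < ℓ ] 𝟙 (w (f x))
        ≡⟨ cong (∑[ v < n ] 𝟙 (inClosedN G v ∧ w v) +_) (∑-image f-injective f∈VX VX⊆f (𝟙 ∘ w)) ⟨
      ∑[ v < n ] 𝟙 (inClosedN G v ∧ w v) + ∑[ v < n ] (𝟙 (inVX v) * 𝟙 (w v))
        ≡⟨ ∑-distrib-+ {n} (λ v → 𝟙 (inClosedN G v ∧ w v)) _ ⟨
      ∑[ v < n ] (𝟙 (inClosedN G v ∧ w v) + 𝟙 (inVX v) * 𝟙 (w v))
        ≡⟨ sum-cong-≗ {n} (λ v → 𝟙-split (inClosedN G v) (U v) (w v) (w⇒U v)) ⟩
      ∑[ v < n ] 𝟙 (w v)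
        ∎
      where
      w : V G → Bool
      w v = φ (odd v) ∧ oddEnds v

      w⇒U : ∀ v → T (w v) → T (U v)
      w⇒U v wv = odd-endsIn⇒∈U G P₄ ends-in-U (proj₂ (to (T-∧ {φ (odd v)}) wv))

      vertex-symbol : ∀ v → 𝟙 (inClosedN G v ∧ φ (odd v) ∧ isOdd (sumDeg G ℓ 𝒯 (inj₁ v)))
                          ≡ 𝟙 (inClosedN G v ∧ w v)
      vertex-symbol v with inClosedN G v in v∈N
      ... | false = refl
      ... | true  = cong (λ b → 𝟙 (φ (odd v) ∧ b)) (isOdd-sumDeg-𝒯 (inj₁ (refl , from T-≡ v∈N)))

      variable-symbol : ∀ x → 𝟙 (φ (isOdd (d x)) ∧ isOdd (sumDeg G ℓ 𝒯 (inj₂ x))) ≡ 𝟙 (w (f x))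
      variable-symbol x =
        cong₂ (λ e b → 𝟙 (φ (isOdd e) ∧ b)) (d≡deg x) (isOdd-sumDeg-𝒯 (inj₂ (x , refl , refl)))

    oddGained oddLost endsP′ : ℕ
    oddGained = count (gainV G ℓ 𝒯) (allFin n) + count (gainX G ℓ 𝒯 d) (allFin ℓ)
    oddLost   = count (loseV G ℓ 𝒯) (allFin n) + count (loseX G ℓ 𝒯 d) (allFin ℓ)
    endsP′    = ∑[ v < n ] endsIn G P′ v

    oddity-inequality : oddG G + oddGained ≤ endsP′ + oddLost
    oddity-inequality = subst₂ _≤_ gains losses (∑-mono-≤ {n} balance)
      where
      balance : ∀ v → 𝟙 (odd v) + 𝟙 (not (odd v) ∧ oddEnds v) ≤ endsIn G P′ v + 𝟙 (odd v ∧ oddEnds v)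
      balance v = oddity-balance (odd v) (oddEnds v) (endsIn G P′ v) (odd-split v)

      gains : ∑[ v < n ] (𝟙 (odd v) + 𝟙 (not (odd v) ∧ oddEnds v)) ≡ oddG G + oddGained
      gains = trans (∑-distrib-+ {n} (𝟙 ∘ odd) _) (sym (cong₂ _+_ (count-tabulate n id odd) (oddity-count not)))

      losses : ∑[ v < n ] (endsIn G P′ v + 𝟙 (odd v ∧ oddEnds v)) ≡ endsP′ + oddLost
      losses = trans (∑-distrib-+ {n} (endsIn G P′) _) (sym (cong (endsP′ +_) (oddity-count id)))

    total-ends : 2 * length P ≡ 2 * length 𝒯 + endsP′
    total-ends = begin
      2 * length P                                          ≡⟨ ∑-endsIn G P ⟨
      ∑[ v < n ] endsIn G P v                               ≡⟨ sum-cong-≗ {n} endsIn-split ⟩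
      ∑[ v < n ] (endsIn G P₄ v + endsIn G P′ v)            ≡⟨ ∑-distrib-+ {n} (endsIn G P₄) _ ⟩
      ∑[ v < n ] endsIn G P₄ v + endsP′                     ≡⟨ cong (_+ endsP′) (∑-endsIn G P₄) ⟩
      2 * length P₄ + endsP′                                ≡⟨ cong (λ m → 2 * m + endsP′) (↔⇒≡ (⤖⇒↔ σ)) ⟩
      2 * length 𝒯 + endsP′                                 ∎

open PathEnds using (module Counting; ℤ-bound)
open import Data.Nat using (ℕ; _*_)
open import Data.Fin using (Fin)
open import Data.List using (List; length)
open import Data.Integer using (+_; _+_; _≤_)
open import Data.Product using (_,_)

lemma21 : (G : Graph) → Nice G
    → (P : List (Path G)) → IsPathPartition G P
    → (ℓ : ℕ) (𝒯 : List (Trace G ℓ)) (d : Fin ℓ → ℕ)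
    → IsPattern G ℓ 𝒯 d → Encodes G ℓ 𝒯 d (P4 G P)
    → (+ oddG G + oddPattern G ℓ 𝒯 d) + + (2 * length 𝒯) ≤ + (2 * length P)
lemma21 G _ P partition ℓ 𝒯 d _
  (U , (_ , ends-in-U , _) , f , f-injective , f-into , f-onto , (σ , traces) , d≡deg) =
  ℤ-bound (oddG G) oddGained oddLost endsP′ (2 * length 𝒯) oddity-inequality total-ends
  where open Counting G P partition ℓ 𝒯 d U ends-in-U f f-injective f-into f-onto σ traces d≡deg
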